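{- Let $k\ge4$, let $H$ be the $k$-th power of the Hamilton cycle on $[n]$ ($n$ sufficiently large), and let $H_s$ be the subgraph of $H$ induced by $[s]$. Then the map $s\mapsto\gamma(H_s)=\frac{e(H_s)}{s-2}$ is increasing for $s>3$ (i.e. on $\{4,\dots,n\}$), and $\gamma(H_3)=\gamma(H_4)=3$.
   Context: $H$ has vertex set $[n]$ and edges $\{v,v+i\}$ for $v\in[n]$, $i\in[k]$ (addition modulo $n$). For a graph $F$ with $F^\circ$ (the union of the components of $F$ with more than $2$ vertices) having an edge, $\gamma(F)=\frac{e(F^\circ)}{|F^\circ|-2c(F^\circ)}$, where $c$ counts components; for the connected graph $H_s$, $s\ge3$, this equals $e(H_s)/(s-2)$. -}

module Defs where

open import Data.Nat using (ℕ; zero; suc; _+_; _≡ᵇ_)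
open import Data.Nat.DivMod using (_%_)
open import Data.Bool using (Bool; _∨_)
open import Data.List using (List; []; _∷_; length; filterᵇ; concatMap; map)
open import Data.Bool.ListAction using (any)
open import Data.Product using (_×_; _,_)
open import Data.Integer using (+_)
open import Data.Rational using (ℚ; _/_)

-- residue of x modulo n (n is positive in all uses; n = 0 is junk)
modn : ℕ → ℕ → ℕ
modn zero    x = x
modn (suc m) x = x % suc m

range : ℕ → ℕ → List ℕ
range a zero      = []
range a (suc len) = a ∷ range (suc a) len

[_] : ℕ → List ℕ
[ k ] = range 1 k

-- adjacency in the k-th power of the Hamilton cycle on [n]:
-- u ~ v iff v = u + i or u = v + i (mod n) for some i ∈ [k]
adj : (n k u v : ℕ) → Bool
adj n k u v = any (λ i → (modn n (u + i) ≡ᵇ modn n v) ∨ (modn n (v + i) ≡ᵇ modn n u)) [ k ]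

pairs : ℕ → List (ℕ × ℕ)
pairs s = concatMap (λ v → map (λ u → (u , v)) (range 1 (Data.Nat._∸_ v 1))) [ s ]

eH : (n k s : ℕ) → ℕ
eH n k s = length (filterᵇ (λ p → adj n k (Data.Product.proj₁ p) (Data.Product.proj₂ p)) (pairs s))

-- γ(H_s) = e(H_s) / (s - 2), for s ≥ 3 (value 0 for s < 3 is junk, never used)
γH : (n k s : ℕ) → ℚ
γH n k (suc (suc (suc m))) = (+ eH n k (suc (suc (suc m)))) / suc m
γH n k _ = + 0 / 1

{-# OPTIONS --safe #-}
-- Let δ(v) be the number of neighbours of v among 1, …, v − 1, so that
-- e(H_{s+1}) = e(H_s) + δ(s+1).  Since u ~ v implies u+1 ~ v+1, δ is
-- non-decreasing.  Now e(H_{s+1})/(s−1) > e(H_s)/(s−2) amounts to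
-- δ(s+1) > e(H_s)/(s−2), and this inequality propagates from s to s+1:
-- adding δ(s+1) to the numerator and 1 to the denominator keeps the average
-- below δ(s+1) ≤ δ(s+2).  It starts at s = 4 because H_5 is complete for
-- k ≥ 4, giving 6/2 < 4.
module Submission where

open import Defs
open import Data.Nat using (ℕ; suc; _≤_; _<_)
open import Data.Integer using (+_)
open import Data.Rational using (ℚ; _/_) renaming (_<_ to _<ℚ_)
open import Data.Product using (_×_; ∃-syntax)
open import Relation.Binary.PropositionalEquality using (_≡_)

open import Data.Nat using (zero; _+_; _*_; _∸_; _≡ᵇ_; z≤n; s≤s; z<s)
open import Data.Nat.Properties
open import Data.Nat.DivMod using (_%_; %-distribˡ-+)
open import Data.Nat.Combinatorics using (_C_; nC1≡n; nCk+nC[k+1]≡[n+1]C[k+1])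
open import Data.Bool using (Bool; true; false; T; T?)
open import Data.Bool.Properties using (T-∨)
open import Data.List using (List; []; _∷_; _++_; length; map; filterᵇ; concatMap)
open import Data.List.Properties using (length-++; filter-++; filter-all; concatMap-++; ++-identityʳ)
open import Data.List.Relation.Unary.All as All using (All)
open import Data.List.Relation.Unary.Any as Any using (here; there)
open import Data.List.Relation.Unary.Any.Properties using (any⁺; any⁻)
open import Data.List.Membership.Propositional using (_∈_; lose)
open import Data.List.Relation.Binary.Sublist.Propositional using (_⊆_; _∷ʳ_; ⊆-refl)
open import Data.List.Relation.Binary.Sublist.Propositional.Properties using (filter⁺; length-mono-≤)
open import Data.Product using (_,_; uncurry)
import Data.Sum as Sum
open import Function using (_∘_; id; Equivalence)
open import Relation.Nullary using (contradiction)
open import Relation.Binary.PropositionalEquality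
  using (refl; sym; trans; cong; cong₂; subst; subst₂; module ≡-Reasoning)
import Data.Integer as ℤ
import Data.Integer.Properties as ℤₚ
import Data.Rational.Properties as ℚₚ
import Data.Rational.Unnormalised as ℚᵘ
import Data.Rational.Unnormalised.Properties as ℚᵘₚ

open Equivalence using (to; from)

private
  variable
    A B : Set

count : (A → Bool) → List A → ℕ
count p xs = length (filterᵇ p xs)

count-mono-⊆ : ∀ p q {xs ys : List A} → (∀ {x} → T (p x) → T (q x)) →
               xs ⊆ ys → count p xs ≤ count q ys
count-mono-⊆ p q p⇒q xs⊆ys =
  length-mono-≤ (filter⁺ (T? ∘ p) (T? ∘ q) (λ { refl → p⇒q }) xs⊆ys)

count-++ : ∀ p (xs ys : List A) → count p (xs ++ ys) ≡ count p xs + count p ys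
count-++ p xs ys =
  trans (cong length (filter-++ (T? ∘ p) xs ys)) (length-++ (filterᵇ p xs))

count-all : ∀ {p} {xs : List A} → All (T ∘ p) xs → count p xs ≡ length xs
count-all {p = p} all = cong length (filter-all (T? ∘ p) all)

count-map : ∀ p (f : B → A) xs → count p (map f xs) ≡ count (p ∘ f) xs
count-map p f [] = refl
count-map p f (x ∷ xs) with p (f x)
... | true  = cong suc (count-map p f xs)
... | false = count-map p f xs

length-range : ∀ a l → length (range a l) ≡ l
length-range a zero    = refl
length-range a (suc l) = cong suc (length-range (suc a) l)

map-suc-range : ∀ a l → map suc (range a l) ≡ range (suc a) l
map-suc-range a zero    = refl
map-suc-range a (suc l) = cong (suc a ∷_) (map-suc-range (suc a) l)

range-snoc : ∀ a l → range a (suc l) ≡ range a l ++ (a + l ∷ [])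
range-snoc a zero    = cong (_∷ []) (sym (+-identityʳ a))
range-snoc a (suc l) = cong (a ∷_) (trans (range-snoc (suc a) l)
                                          (cong (λ x → range (suc a) l ++ (x ∷ [])) (sym (+-suc a l))))

∈-range⁻ : ∀ {a l x} → x ∈ range a l → a ≤ x × x < a + l
∈-range⁻ {a} {suc l} (here refl) = ≤-refl , m<m+n a z<s
∈-range⁻ {a} {suc l} {x} (there x∈) =
  let 1+a≤x , x<1+a+l = ∈-range⁻ x∈ in <⇒≤ 1+a≤x , subst (x <_) (sym (+-suc a l)) x<1+a+l

∈-range⁺ : ∀ {a l x} → a ≤ x → x < a + l → x ∈ range a l
∈-range⁺ {a} {zero} {x} a≤x x<a+0 = contradiction a≤x (<⇒≱ (subst (x <_) (+-identityʳ a) x<a+0))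
∈-range⁺ {a} {suc l} {x} a≤x x<a+1+l with m≤n⇒m<n∨m≡n a≤x
... | Sum.inj₂ refl = here refl
... | Sum.inj₁ a<x  = there (∈-range⁺ a<x (subst (x <_) (+-suc a l) x<a+1+l))

pairs-suc : ∀ s → pairs (suc s) ≡ pairs s ++ map (_, suc s) (range 1 s)
pairs-suc s = begin
  concatMap row (range 1 (suc s))           ≡⟨ cong (concatMap row) (range-snoc 1 s) ⟩
  concatMap row (range 1 s ++ (suc s ∷ [])) ≡⟨ concatMap-++ row (range 1 s) (suc s ∷ []) ⟩
  pairs s ++ (row (suc s) ++ [])            ≡⟨ cong (pairs s ++_) (++-identityʳ (row (suc s))) ⟩
  pairs s ++ row (suc s)                    ∎
  where
  open ≡-Reasoning
  row : ℕ → List (ℕ × ℕ)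
  row v = map (_, v) (range 1 (v ∸ 1))

CompleteOn : (ℕ → ℕ → Bool) → ℕ → Set
CompleteOn R m = ∀ {u v} → 1 ≤ u → u < v → v ≤ m → T (R u v)

module InducedEdges (R : ℕ → ℕ → Bool) where

  edges : ℕ → ℕ
  edges s = count (uncurry R) (pairs s)

  leftDegree : ℕ → ℕ
  leftDegree v = count (λ u → R u v) (range 1 (v ∸ 1))

  edges-suc : ∀ s → edges (suc s) ≡ edges s + leftDegree (suc s)
  edges-suc s = begin
    count (uncurry R) (pairs (suc s))        ≡⟨ cong (count (uncurry R)) (pairs-suc s) ⟩
    count (uncurry R) (pairs s ++ newPairs)  ≡⟨ count-++ (uncurry R) (pairs s) newPairs ⟩
    edges s + count (uncurry R) newPairs     ≡⟨ cong (λ δ → edges s + δ) (count-map (uncurry R) (_, suc s) (range 1 s)) ⟩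
    edges s + leftDegree (suc s)             ∎
    where
    open ≡-Reasoning
    newPairs : List (ℕ × ℕ)
    newPairs = map (_, suc s) (range 1 s)

  leftDegree-mono : (∀ {u v} → T (R u v) → T (R (suc u) (suc v))) →
                    ∀ v → leftDegree v ≤ leftDegree (suc v)
  leftDegree-mono shift zero    = z≤n
  leftDegree-mono shift (suc w) = begin
    count (λ u → R u (suc w)) (range 1 w) ≤⟨ count-mono-⊆ (λ u → R u (suc w)) (after ∘ suc) {range 1 w} shift ⊆-refl ⟩
    count (after ∘ suc) (range 1 w)       ≡⟨ count-map after suc (range 1 w) ⟨
    count after (map suc (range 1 w))     ≡⟨ cong (count after) (map-suc-range 1 w) ⟩
    count after (range 2 w)               ≤⟨ count-mono-⊆ after after {range 2 w} id (1 ∷ʳ ⊆-refl) ⟩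
    leftDegree (suc (suc w))              ∎
    where
    open ≤-Reasoning
    after : ℕ → Bool
    after u = R u (suc (suc w))

  leftDegree-complete : ∀ {m} → CompleteOn R m → ∀ {v} → v ≤ m → leftDegree v ≡ v ∸ 1
  leftDegree-complete complete {zero}  _   = refl
  leftDegree-complete complete {suc w} v≤m =
    trans (count-all (All.tabulate adjacent)) (length-range 1 w)
    where
    adjacent : ∀ {u} → u ∈ range 1 w → T (R u (suc w))
    adjacent u∈ = let 1≤u , u<v = ∈-range⁻ u∈ in complete 1≤u u<v v≤m

  edges-complete : ∀ {m} → CompleteOn R m → ∀ {s} → s ≤ m → edges s ≡ s C 2
  edges-complete complete {zero}  _   = refl
  edges-complete complete {suc s} s<m = begin
    edges (suc s)                ≡⟨ edges-suc s ⟩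
    edges s + leftDegree (suc s) ≡⟨ cong₂ _+_ (edges-complete complete (<⇒≤ s<m))
                                               (leftDegree-complete complete s<m) ⟩
    s C 2 + s                    ≡⟨ +-comm (s C 2) s ⟩
    s + s C 2                    ≡⟨ cong (_+ s C 2) (nC1≡n s) ⟨
    s C 1 + s C 2                ≡⟨ nCk+nC[k+1]≡[n+1]C[k+1] s 1 ⟩
    suc s C 2                    ∎
    where open ≡-Reasoning

modn-suc : ∀ n {a b} → modn n a ≡ modn n b → modn n (suc a) ≡ modn n (suc b)
modn-suc zero    a≡b = cong suc a≡b
modn-suc (suc m) {a} {b} a≡b = begin
  suc a % suc m                      ≡⟨ %-distribˡ-+ 1 a (suc m) ⟩
  (1 % suc m + a % suc m) % suc m    ≡⟨ cong (λ r → (1 % suc m + r) % suc m) a≡b ⟩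
  (1 % suc m + b % suc m) % suc m    ≡⟨ %-distribˡ-+ 1 b (suc m) ⟨
  suc b % suc m                      ∎
  where open ≡-Reasoning

adj-shift : ∀ n k {u v} → T (adj n k u v) → T (adj n k (suc u) (suc v))
adj-shift n k = any⁺ _ ∘ Any.map (from T-∨ ∘ Sum.map shift shift ∘ to T-∨) ∘ any⁻ _ [ k ]
  where
  shift : ∀ {a b} → T (modn n a ≡ᵇ modn n b) → T (modn n (suc a) ≡ᵇ modn n (suc b))
  shift = ≡⇒≡ᵇ _ _ ∘ modn-suc n ∘ ≡ᵇ⇒≡ _ _

adj-+ : ∀ n k u {i} → i ∈ [ k ] → T (adj n k u (u + i))
adj-+ n k u {i} i∈[k] = any⁺ _ (lose i∈[k] (from T-∨ (Sum.inj₁ (≡⇒≡ᵇ r r refl))))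
  where r = modn n (u + i)

adj-complete : ∀ n k → CompleteOn (adj n k) (suc k)
adj-complete n k {u} {v} 1≤u u<v v≤1+k =
  subst (T ∘ adj n k u) (m+[n∸m]≡n (<⇒≤ u<v))
        (adj-+ n k u (∈-range⁺ (m<n⇒0<n∸m u<v) (s≤s (∸-mono v≤1+k 1≤u))))

module _ (a d : ℕ → ℕ) (c : ℕ)
         (a-suc : ∀ j → a (suc j) ≡ a j + d (suc j))
         (d-mono : ∀ j → d j ≤ d (suc j))
         (a₀<d₁*c : a 0 < d 1 * c) where

  average<increment : ∀ j → a j < d (suc j) * (c + j)
  average<increment zero    = subst (λ c′ → a 0 < d 1 * c′) (sym (+-identityʳ c)) a₀<d₁*c
  average<increment (suc j) = begin-strict
    a (suc j)                        ≡⟨ a-suc j ⟩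
    a j + d (suc j)                  <⟨ +-monoˡ-< (d (suc j)) (average<increment j) ⟩
    d (suc j) * (c + j) + d (suc j)  ≡⟨ +-comm _ (d (suc j)) ⟩
    d (suc j) + d (suc j) * (c + j)  ≡⟨ *-suc (d (suc j)) (c + j) ⟨
    d (suc j) * suc (c + j)          ≡⟨ cong (d (suc j) *_) (+-suc c j) ⟨
    d (suc j) * (c + suc j)          ≤⟨ *-monoˡ-≤ (c + suc j) (d-mono (suc j)) ⟩
    d (suc (suc j)) * (c + suc j)    ∎
    where open ≤-Reasoning

  average-increasing : ∀ j → a j * suc (c + j) < a (suc j) * (c + j)
  average-increasing j = begin-strict
    a j * suc (c + j)                    ≡⟨ *-suc (a j) (c + j) ⟩
    a j + a j * (c + j)                  <⟨ +-monoˡ-< (a j * (c + j)) (average<increment j) ⟩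
    d (suc j) * (c + j) + a j * (c + j)  ≡⟨ *-distribʳ-+ (c + j) (d (suc j)) (a j) ⟨
    (d (suc j) + a j) * (c + j)          ≡⟨ cong (_* (c + j)) (trans (+-comm (d (suc j)) (a j)) (sym (a-suc j))) ⟩
    a (suc j) * (c + j)                  ∎
    where open ≤-Reasoning

fraction-< : ∀ a b c d → a * suc d < b * suc c → (+ a) / suc c <ℚ (+ b) / suc d
fraction-< a b c d ad<bc = ℚₚ.toℚᵘ-cancel-<
  (ℚᵘₚ.<-respˡ-≃ (ℚᵘₚ.≃-sym (ℚₚ.toℚᵘ-fromℚᵘ (ℚᵘ.mkℚᵘ (+ a) c)))
  (ℚᵘₚ.<-respʳ-≃ (ℚᵘₚ.≃-sym (ℚₚ.toℚᵘ-fromℚᵘ (ℚᵘ.mkℚᵘ (+ b) d)))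
  (ℚᵘ.*<* (subst₂ ℤ._<_ (ℤₚ.pos-* a (suc d)) (ℤₚ.pos-* b (suc c)) (ℤ.+<+ ad<bc)))))

-- eH n k is definitionally edges, so γH n k (4 + j) unfolds to (+ edges (4 + j)) / suc (suc j).
module _ (n k : ℕ) (4≤k : 4 ≤ k) where
  open InducedEdges (adj n k)

  private
    5≤1+k : 5 ≤ suc k
    5≤1+k = s≤s 4≤k

    4≤1+k : 4 ≤ suc k
    4≤1+k = <⇒≤ 5≤1+k

    e₄<δ₅*2 : edges 4 < leftDegree 5 * 2
    e₄<δ₅*2 = subst₂ _<_ (sym (edges-complete (adj-complete n k) 4≤1+k))
                         (cong (_* 2) (sym (leftDegree-complete (adj-complete n k) 5≤1+k)))
                         (<ᵇ⇒< 6 8 _)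

  γH-increasing : ∀ s → 4 ≤ s → γH n k s <ℚ γH n k (suc s)
  γH-increasing (suc (suc (suc (suc j)))) (s≤s (s≤s (s≤s (s≤s z≤n)))) =
    fraction-< (edges (4 + j)) (edges (5 + j)) (suc j) (suc (suc j))
      (average-increasing (λ i → edges (4 + i)) (λ i → leftDegree (4 + i)) 2
         (λ i → edges-suc (4 + i)) (λ i → leftDegree-mono (adj-shift n k) (4 + i)) e₄<δ₅*2 j)

  γH-3 : γH n k 3 ≡ (+ 3) / 1
  γH-3 = cong (λ e → (+ e) / 1) (edges-complete (adj-complete n k) (<⇒≤ 4≤1+k))

  γH-4 : γH n k 4 ≡ (+ 3) / 1
  γH-4 = cong (λ e → (+ e) / 2) (edges-complete (adj-complete n k) 4≤1+k)

lemma3p3 : ∀ (k : ℕ) → 4 ≤ k →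
    ∃[ n₀ ] ∀ (n : ℕ) → n₀ ≤ n →
    (∀ (s : ℕ) → 4 ≤ s → s < n → γH n k s <ℚ γH n k (suc s))
    × γH n k 3 ≡ (+ 3) / 1
    × γH n k 4 ≡ (+ 3) / 1
lemma3p3 k 4≤k = 0 , λ n _ →
  (λ s 4≤s _ → γH-increasing n k 4≤k s 4≤s) , γH-3 n k 4≤k , γH-4 n k 4≤k
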